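{- There is an $L > 0$ such that the following holds. For any sufficiently large $m$, there exists a graph $T$ with $2m \leq v(T) \leq Lm$, maximum degree at most $L$, and a set $Z\subseteq V(T)$ of $m$ vertices, such that for every $Z' \subseteq Z$ with $|Z'| < m/2$ and $|V(T) \setminus Z'|$ even, the graph $T - Z'$ has a perfect matching.
   Context: Here $T$ is an ordinary (2-uniform) graph and $T-Z'$ denotes the subgraph induced on $V(T)\setminus Z'$. -}

module Defs where

open import Data.Nat using (ℕ; _≤_)
open import Data.Bool using (Bool; true; false)
open import Data.Fin using (Fin)
open import Data.Fin.Subset using (Subset; _∈_; _∉_; ∣_∣)
open import Data.Vec using (tabulate)
open import Data.Product using (Σ; _×_)
open import Relation.Binary.PropositionalEquality using (_≡_; _≢_)

record Graph (n : ℕ) : Set where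
  field
    adj     : Fin n → Fin n → Bool
    symm    : ∀ u v → adj u v ≡ adj v u
    irrefl  : ∀ v → adj v v ≡ false

open Graph public

nbhd : ∀ {n} → Graph n → Fin n → Subset n
nbhd G v = tabulate (adj G v)

degree : ∀ {n} → Graph n → Fin n → ℕ
degree G v = ∣ nbhd G v ∣

MaxDegreeAtMost : ∀ {n} → Graph n → ℕ → Set
MaxDegreeAtMost G d = ∀ v → degree G v ≤ d

-- T - Z' (the subgraph induced on V(T) \ Z') has a perfect matching:
-- a partner function on the remaining vertices which is a fixed-point-free
-- involution mapping each remaining vertex to a remaining neighbour.
HasPerfectMatchingAfterDeleting : ∀ {n} → Graph n → Subset n → Set
HasPerfectMatchingAfterDeleting {n} G Z' =
  Σ (Fin n → Fin n) λ p →
    ∀ v → v ∉ Z' →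
      (p v ∉ Z') × (adj G v (p v) ≡ true) × (p (p v) ≡ v)

{-# OPTIONS --safe #-}
-- Take the square of the path 0 – 1 – ⋯ – (2m−1) (vertices at distance at most
-- 2 are adjacent), whose neighbourhoods lie in windows of five consecutive
-- vertices, and let Z be the odd positions. Deleting a set Z' ⊆ Z never deletes
-- two consecutive vertices, so consecutive survivors are at distance at most 2
-- and form a path in T − Z'; when there is an even number of them, pairing them
-- off along that path is a perfect matching.
module Submission where

open import Defs
open import Data.Nat using (ℕ; zero; suc; _≤_; _<_; _+_; _*_; _∸_; _<ᵇ_; z≤n; s≤s)
open import Data.Nat.Properties
  using (≤-trans; ≤-reflexive; n≤1+n; m≤n+m∸n; +-monoʳ-≤; +-comm; *-comm; *-monoˡ-≤; +-∸-assoc)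
open import Data.Nat.Divisibility using (_∣_; ∣1⇒≡1; ∣m+n∣m⇒∣n; ∣-refl)
open import Data.Fin using (Fin; toℕ; zero; suc)
open import Data.Fin.Subset using (Subset; _⊆_; _∉_; ∣_∣; inside; outside)
open import Data.Fin.Subset.Properties using (drop-there; drop-∷-⊆; ∣p∣≤n)
open import Data.Vec using ([]; _∷_; tabulate)
open import Data.Vec.Base using (here; there)
open import Data.Bool using (Bool; true; false)
open import Data.Product using (Σ; _×_; _,_)
open import Data.Empty using (⊥-elim)
open import Function using (id; _∘_)
open import Relation.Nullary using (¬_)
open import Relation.Binary.PropositionalEquality using (_≡_; refl; cong; subst; trans)

-- close a b holds iff 0 < ∣ a - b ∣ ≤ 2; the recursive form makes
-- close (suc a) (suc b) = close a b hold definitionally.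
close : ℕ → ℕ → Bool
close zero    zero    = false
close zero    (suc b) = b <ᵇ 2
close (suc a) zero    = a <ᵇ 2
close (suc a) (suc b) = close a b

close-sym : ∀ a b → close a b ≡ close b a
close-sym zero    zero    = refl
close-sym zero    (suc b) = refl
close-sym (suc a) zero    = refl
close-sym (suc a) (suc b) = close-sym a b

close-irrefl : ∀ a → close a a ≡ false
close-irrefl zero    = refl
close-irrefl (suc a) = close-irrefl a

close-above : ∀ a i → 3 + a ≤ i → close a i ≡ false
close-above zero    _       (s≤s (s≤s (s≤s _))) = refl
close-above (suc a) (suc i) (s≤s 3+a≤i)         = close-above a i 3+a≤i

close-below : ∀ a i → 3 + i ≤ a → close a i ≡ false
close-below a i 3+i≤a = trans (close-sym a i) (close-above i a 3+i≤a)

pathSquare : ∀ n → Graph n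
pathSquare n = record
  { adj    = λ u v → close (toℕ u) (toℕ v)
  ; symm   = λ u v → close-sym (toℕ u) (toℕ v)
  ; irrefl = λ v → close-irrefl (toℕ v)
  }

∣tabulate∣≤ : ∀ n (h : ℕ → Bool) k → (∀ i → k ≤ i → h i ≡ false) →
              ∣ tabulate {n = n} (h ∘ toℕ) ∣ ≤ k
∣tabulate∣≤ zero    h k       _ = z≤n
∣tabulate∣≤ (suc n) h zero    h≡false rewrite h≡false 0 z≤n =
  ∣tabulate∣≤ n (h ∘ suc) zero (λ i _ → h≡false (suc i) z≤n)
∣tabulate∣≤ (suc n) h (suc k) h≡false
  with h 0 | ∣tabulate∣≤ n (h ∘ suc) k (λ i k≤i → h≡false (suc i) (s≤s k≤i))
... | true  | rest = s≤s rest
... | false | rest = ≤-trans rest (n≤1+n k)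

∣tabulate∣≤-window : ∀ n (h : ℕ → Bool) a k →
                     (∀ i → i < a → h i ≡ false) → (∀ i → a + k ≤ i → h i ≡ false) →
                     ∣ tabulate {n = n} (h ∘ toℕ) ∣ ≤ k
∣tabulate∣≤-window n       h zero    k _     above = ∣tabulate∣≤ n h k above
∣tabulate∣≤-window zero    h (suc a) k _     _     = z≤n
∣tabulate∣≤-window (suc n) h (suc a) k below above rewrite below 0 (s≤s z≤n) =
  ∣tabulate∣≤-window n (h ∘ suc) a k (λ i → below (suc i) ∘ s≤s) (λ i → above (suc i) ∘ s≤s)

pathSquare-maxDegree : ∀ n → MaxDegreeAtMost (pathSquare n) 5
pathSquare-maxDegree n v =
  ∣tabulate∣≤-window n (close c) (c ∸ 2) 5
    (λ i i<c∸2 → close-below c i (lower c i<c∸2))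
    (λ i c∸2+5≤i → close-above c i (≤-trans upper c∸2+5≤i))
  where
  c : ℕ
  c = toℕ v
  lower : ∀ u {i} → i < u ∸ 2 → 3 + i ≤ u
  lower (suc (suc u)) i<u = s≤s (s≤s i<u)
  upper : 3 + c ≤ c ∸ 2 + 5
  upper = ≤-trans (+-monoʳ-≤ 3 (m≤n+m∸n c 2)) (≤-reflexive (+-comm 5 (c ∸ 2)))

-- inside∷_ asks for a proof about outside ∷ D rather than D, so that
-- pathSquare-matching below is structurally recursive.
data NoTwoConsecutive : ∀ {n} → Subset n → Set where
  []        : NoTwoConsecutive []
  outside∷_ : ∀ {n} {D : Subset n} → NoTwoConsecutive D → NoTwoConsecutive (outside ∷ D)
  inside∷[] : NoTwoConsecutive (inside ∷ [])
  inside∷_  : ∀ {n} {D : Subset n} → NoTwoConsecutive (outside ∷ D) →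
              NoTwoConsecutive (inside ∷ outside ∷ D)

NoTwoConsecutive-⊆ : ∀ {n} {D E : Subset n} → D ⊆ E → NoTwoConsecutive E → NoTwoConsecutive D
NoTwoConsecutive-⊆ {D = []}                    _   []             = []
NoTwoConsecutive-⊆ {D = outside ∷ D}           D⊆E (outside∷ ntc) = outside∷ NoTwoConsecutive-⊆ (drop-∷-⊆ D⊆E) ntc
NoTwoConsecutive-⊆ {D = inside ∷ _}            D⊆E (outside∷ _)   with D⊆E here
... | ()
NoTwoConsecutive-⊆ {D = outside ∷ []}          _   inside∷[]      = outside∷ []
NoTwoConsecutive-⊆ {D = inside ∷ []}           _   inside∷[]      = inside∷[]
NoTwoConsecutive-⊆ {D = outside ∷ D}           D⊆E (inside∷ ntc)  = outside∷ NoTwoConsecutive-⊆ (drop-∷-⊆ D⊆E) ntc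
NoTwoConsecutive-⊆ {D = inside ∷ outside ∷ D}  D⊆E (inside∷ ntc)  = inside∷ NoTwoConsecutive-⊆ (drop-∷-⊆ D⊆E) ntc
NoTwoConsecutive-⊆ {D = inside ∷ inside ∷ _}   D⊆E (inside∷ _)    with D⊆E (there here)
... | there ()

PathSquareMatching : ∀ {n} → Subset n → Set
PathSquareMatching {n} D = HasPerfectMatchingAfterDeleting (pathSquare n) D

IsPathSquareMatching : ∀ {n} → Subset n → (Fin n → Fin n) → Set
IsPathSquareMatching D p =
  ∀ v → v ∉ D → (p v ∉ D) × (close (toℕ v) (toℕ (p v)) ≡ true) × (p (p v) ≡ v)

matching-[] : PathSquareMatching []
matching-[] = id , λ ()

matching-inside∷ : ∀ {n} {D : Subset n} → PathSquareMatching D → PathSquareMatching (inside ∷ D)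
matching-inside∷ {D = D} (p , matched) = q , matched′
  where
  q : Fin _ → Fin _
  q zero    = zero
  q (suc i) = suc (p i)
  matched′ : IsPathSquareMatching (inside ∷ D) q
  matched′ zero    0∉ = ⊥-elim (0∉ here)
  matched′ (suc i) i∉ with matched i (i∉ ∘ there)
  ... | pi∉ , adjacent , involutive = pi∉ ∘ drop-there , adjacent , cong suc involutive

matching-outside∷outside∷ : ∀ {n} {D : Subset n} → PathSquareMatching D →
                            PathSquareMatching (outside ∷ outside ∷ D)
matching-outside∷outside∷ {D = D} (p , matched) = q , matched′
  where
  q : Fin _ → Fin _
  q zero          = suc zero
  q (suc zero)    = zero
  q (suc (suc i)) = suc (suc (p i))
  matched′ : IsPathSquareMatching (outside ∷ outside ∷ D) q
  matched′ zero          _  = (λ { (there ()) }) , refl , refl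
  matched′ (suc zero)    _  = (λ ()) , refl , refl
  matched′ (suc (suc i)) i∉ with matched i (i∉ ∘ there ∘ there)
  ... | pi∉ , adjacent , involutive =
    pi∉ ∘ drop-there ∘ drop-there , adjacent , cong (λ (j : Fin _) → suc (suc j)) involutive

matching-outside∷inside∷outside∷ : ∀ {n} {D : Subset n} → PathSquareMatching D →
                                   PathSquareMatching (outside ∷ inside ∷ outside ∷ D)
matching-outside∷inside∷outside∷ {D = D} (p , matched) = q , matched′
  where
  q : Fin _ → Fin _
  q zero                = suc (suc zero)
  q (suc zero)          = suc zero
  q (suc (suc zero))    = zero
  q (suc (suc (suc i))) = suc (suc (suc (p i)))
  matched′ : IsPathSquareMatching (outside ∷ inside ∷ outside ∷ D) q
  matched′ zero                _  = (λ { (there (there ())) }) , refl , refl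
  matched′ (suc zero)          1∉ = ⊥-elim (1∉ (there here))
  matched′ (suc (suc zero))    _  = (λ ()) , refl , refl
  matched′ (suc (suc (suc i))) i∉ with matched i (i∉ ∘ there ∘ there ∘ there)
  ... | pi∉ , adjacent , involutive =
    pi∉ ∘ drop-there ∘ drop-there ∘ drop-there , adjacent , cong (λ (j : Fin _) → suc (suc (suc j))) involutive

2∤1 : ¬ (2 ∣ 1)
2∤1 2∣1 with ∣1⇒≡1 2∣1
... | ()

2∣[2+n]∸m⇒2∣n∸m : ∀ {m n} → m ≤ n → 2 ∣ (2 + n) ∸ m → 2 ∣ n ∸ m
2∣[2+n]∸m⇒2∣n∸m m≤n 2∣2+n∸m = ∣m+n∣m⇒∣n (subst (2 ∣_) (+-∸-assoc 2 m≤n) 2∣2+n∸m) ∣-refl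

pathSquare-matching : ∀ {n} {D : Subset n} → NoTwoConsecutive D → 2 ∣ n ∸ ∣ D ∣ →
                      PathSquareMatching D
pathSquare-matching []                   _    = matching-[]
pathSquare-matching inside∷[]            _    = matching-inside∷ matching-[]
pathSquare-matching (inside∷ ntc)        even = matching-inside∷ (pathSquare-matching ntc even)
pathSquare-matching (outside∷ [])        odd  = ⊥-elim (2∤1 odd)
pathSquare-matching (outside∷ inside∷[]) odd  = ⊥-elim (2∤1 odd)
pathSquare-matching {D = outside ∷ outside ∷ D} (outside∷ outside∷ ntc) even =
  matching-outside∷outside∷ (pathSquare-matching ntc (2∣[2+n]∸m⇒2∣n∸m (∣p∣≤n D) even))
pathSquare-matching {D = outside ∷ inside ∷ outside ∷ D} (outside∷ inside∷ outside∷ ntc) even =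
  matching-outside∷inside∷outside∷ (pathSquare-matching ntc (2∣[2+n]∸m⇒2∣n∸m (∣p∣≤n D) even))

oddPositions : ∀ m → Subset (m * 2)
oddPositions zero    = []
oddPositions (suc m) = outside ∷ inside ∷ oddPositions m

∣oddPositions∣ : ∀ m → ∣ oddPositions m ∣ ≡ m
∣oddPositions∣ zero    = refl
∣oddPositions∣ (suc m) = cong suc (∣oddPositions∣ m)

oddPositions-noTwoConsecutive : ∀ m → NoTwoConsecutive (oddPositions m)
oddPositions-noTwoConsecutive zero          = []
oddPositions-noTwoConsecutive (suc zero)    = outside∷ inside∷[]
oddPositions-noTwoConsecutive (suc (suc m)) = outside∷ inside∷ oddPositions-noTwoConsecutive (suc m)

lemma6p5 : Σ ℕ λ L → (0 < L) × (Σ ℕ λ m₀ → ∀ m → m₀ ≤ m →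
             Σ ℕ λ n → Σ (Graph n) λ T →
               (2 * m ≤ n) × (n ≤ L * m) × MaxDegreeAtMost T L ×
               (Σ (Subset n) λ Z → (∣ Z ∣ ≡ m) ×
                 (∀ (Z' : Subset n) → Z' ⊆ Z → 2 * ∣ Z' ∣ < m → 2 ∣ (n ∸ ∣ Z' ∣) →
                   HasPerfectMatchingAfterDeleting T Z')))
lemma6p5 = 5 , s≤s z≤n , 0 , λ m _ →
  m * 2 , pathSquare (m * 2) ,
  ≤-reflexive (*-comm 2 m) ,
  ≤-trans (≤-reflexive (*-comm m 2)) (*-monoˡ-≤ m {2} {5} (s≤s (s≤s z≤n))) ,
  pathSquare-maxDegree (m * 2) ,
  oddPositions m , ∣oddPositions∣ m ,
  λ Z' Z'⊆Z _ even →
    pathSquare-matching (NoTwoConsecutive-⊆ Z'⊆Z (oddPositions-noTwoConsecutive m)) even
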